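{- Let $p$ be a prime, $K$ a finite extension of $\mathbb{Q}_p$ with maximal ideal $\mathfrak{p}$ of $\mathcal{O}_K$. Let $x \in K$ be nonzero with $\nu_{\mathfrak{p}}(x) = bp^{k}$ where $b \in \mathbb{Q}$, $\nu_p(b) = 0$ and $k \geq 0$ an integer. Define $\kappa_0 := \nu_{\mathfrak{p}}(x) \bmod p$, $\kappa_1 := \nu_p(\lfloor \nu_{\mathfrak{p}}(x) \rfloor_p)$, and for $i \geq 2$, $\kappa_i := \nu_p(\lfloor \kappa_{i-1}-1 \rfloor_p)$ if $\kappa_{i-1} < +\infty$ and $\kappa_i := +\infty$ if $\kappa_{i-1}=+\infty$. If the $\nu_{\mathfrak{p}}$ sequence of $x$ is not eventually $+\infty$, then there is a unique positive integer $N$ with $1 \leq \kappa_N \leq p$ (and $\kappa_i=+\infty$ for $i>N$), and the $\mathrm{inc}_{\mathfrak{p}}$ sequence of $x$ is of the form \[(\underbrace{ -1, -1, \ldots, -1}_{\kappa_0 \text{ copies}}, \mathcal{S}_{\kappa_1, p}, \mathcal{S}_{\kappa_2,p}, \ldots, \mathcal{S}_{\kappa_N,p}, \mathcal{S}_{\kappa_N,p}, \mathcal{S}_{\kappa_N,p}, \ldots)\] (concatenation of finite sequences, with $\mathcal{S}_{\kappa_N,p}$ repeated forever). As a result, the $\nu_{\mathfrak{p}}$ sequence and the $\mathrm{inc}_{\mathfrak{p}}$ sequence of $x$ are eventually periodic of period $\kappa_N$.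
   Context: $\nu_{\mathfrak{p}}$ is the unique discrete valuation on $K$ extending $\nu_p$ (so $\nu_{\mathfrak{p}}(p)=1$, values in $\mathbb{Q}\cup\{+\infty\}$). $D_{K,\mathfrak{p}}(x) = x\,\nu_{\mathfrak{p}}(x)/p$ for $x\neq 0$, $D_{K,\mathfrak{p}}(0)=0$; $D^i_{K,\mathfrak{p}}$ is the $i$-th iterate. The $\nu_{\mathfrak{p}}$ sequence of $x$ is $(\nu_{\mathfrak{p}}(D^i_{K,\mathfrak{p}}(x)))_{i\ge 0}$, and the $\mathrm{inc}_{\mathfrak{p}}$ sequence is $(\nu_{\mathfrak{p}}(D^{i+1}_{K,\mathfrak{p}}(x)) - \nu_{\mathfrak{p}}(D^{i}_{K,\mathfrak{p}}(x)))_{i \ge 0}$. For a rational number $r$ with $\nu_p(r) \geq 0$, $r \bmod p$ denotes the unique $s \in \{0,1,\ldots,p-1\}$ with $\nu_p(r-s) \geq 1$, and $\lfloor r \rfloor_p := r - (r \bmod p)$; $\nu_p(0)=+\infty$. For an integer $k \geq 1$, the $k$-segment is the finite sequence $\mathcal{S}_{k,p} := (k-1, -1, -1, \ldots, -1)$ with $(k-1 \bmod p)$ copies of $-1$. -}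

module Defs where

open import Level using (Level; _⊔_) renaming (suc to lsuc)
open import Data.Bool using (Bool; true; false; if_then_else_)
open import Data.Nat as ℕ using (ℕ; zero; suc; _∸_; _<ᵇ_)
open import Data.Nat.DivMod using (_%_; _/_)
open import Data.Integer as ℤ using (ℤ; +_; -[1+_])
open import Data.Rational as ℚ using (ℚ; 0ℚ; 1ℚ)
open import Data.List using (List; []; _∷_; replicate; length; upTo; _++_; concatMap)
open import Data.Product using (∃; _×_; _,_)
open import Relation.Nullary using (¬_)
open import Relation.Binary.PropositionalEquality using (_≡_)
open import Algebra.Bundles using (CommutativeRing)

data ℤ∞ : Set where
  fin : ℤ → ℤ∞
  ∞   : ℤ∞

data ℚ∞ : Set where
  fin : ℚ → ℚ∞
  ∞   : ℚ∞

_+∞_ : ℚ∞ → ℚ∞ → ℚ∞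
fin a +∞ fin b = fin (a ℚ.+ b)
_     +∞ _     = ∞

data _≤∞_ : ℚ∞ → ℚ∞ → Set where
  fin≤fin : ∀ {a b} → a ℚ.≤ b → fin a ≤∞ fin b
  _≤∞∞    : ∀ a → a ≤∞ ∞

min∞ : ℚ∞ → ℚ∞ → ℚ∞
min∞ (fin a) (fin b) = fin (if a ℚ.≤ᵇ b then a else b)
min∞ (fin a) ∞       = fin a
min∞ ∞       b       = b

ℤ→ℚ : ℤ → ℚ
ℤ→ℚ z = z ℚ./ 1

ℕ→ℚ : ℕ → ℚ
ℕ→ℚ n = ℤ→ℚ (+ n)

toℚ∞ : ℤ∞ → ℚ∞
toℚ∞ (fin z) = fin (ℤ→ℚ z)
toℚ∞ ∞       = ∞

-- p-adic valuation ν_p on ℚ (p is meant to be a prime; for p < 2 the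
-- definitions below are junk and never used).

-- multiplicity of p in n, computed with fuel (fuel n suffices for n > 0)
multFuel : ℕ → ℕ → ℕ → ℕ
multFuel (suc (suc q)) n (suc f) with n % suc (suc q) ℕ.≟ 0
... | Relation.Nullary.yes _ = suc (multFuel (suc (suc q)) (n / suc (suc q)) f)
... | Relation.Nullary.no  _ = 0
multFuel _ _ _ = 0

multℕ : ℕ → ℕ → ℕ
multℕ p n = multFuel p n n

νp : ℕ → ℚ → ℤ∞
νp p r with ℚ.↥ r
... | + zero = ∞
... | z      = fin (+ multℕ p ℤ.∣ z ∣ ℤ.- + multℕ p (ℚ.↧ₙ r))

geq1 : ℤ∞ → Bool
geq1 ∞       = true
geq1 (fin z) = + 1 ℤ.≤ᵇ z

-- r mod p : the (unique, when ν_p(r) ≥ 0) s ∈ {0,…,p-1} with ν_p(r - s) ≥ 1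
firstWith : (ℕ → Bool) → List ℕ → ℕ
firstWith P []       = 0
firstWith P (s ∷ ss) = if P s then s else firstWith P ss

modp : ℕ → ℚ → ℕ
modp p r = firstWith (λ s → geq1 (νp p (r ℚ.- ℕ→ℚ s))) (upTo p)

floorp : ℕ → ℚ → ℚ
floorp p r = r ℚ.- ℕ→ℚ (modp p r)

κtail : ℕ → ℚ → ℕ → ℤ∞        -- κtail p v i = κ_{i+1}
κtail p v zero    = νp p (floorp p v)
κtail p v (suc i) with κtail p v i
... | fin z = νp p (floorp p (ℤ→ℚ z ℚ.- 1ℚ))
... | ∞     = ∞

κ : ℕ → ℚ → ℕ → ℤ∞
κ p v zero    = fin (+ modp p v)
κ p v (suc i) = κtail p v i

-- 1/p as a rational (junk value 0 for p = 0)
inv : ℕ → ℚ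
inv zero    = 0ℚ
inv (suc n) = + 1 ℚ./ suc n

modℕ : ℕ → ℕ → ℕ
modℕ zero    n = n
modℕ (suc m) n = n % suc m

segHead : ℕ → ℤ
segHead k = + k ℤ.- + 1

segTail : ℕ → ℕ → List ℤ
segTail p k = replicate (modℕ p (k ∸ 1)) (ℤ.- + 1)

segment : ℕ → ℕ → List ℤ
segment p k = segHead k ∷ segTail p k

nth : List ℤ → ℕ → ℤ
nth []       _       = + 0
nth (a ∷ as) zero    = a
nth (a ∷ as) (suc i) = nth as i

nthℕ : List ℕ → ℕ → ℕ
nthℕ []       _       = 0
nthℕ (a ∷ as) zero    = a
nthℕ (a ∷ as) (suc i) = nthℕ as i

-- the infinite word  pre ++ per ++ per ++ per ++ …   (per nonempty: h ∷ t)
ultimately : List ℤ → ℤ → List ℤ → ℕ → ℤ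
ultimately pre h t i =
  if i <ᵇ length pre then nth pre i
  else nth (h ∷ t) ((i ∸ length pre) % suc (length t))

incWord : ℕ → ℕ → List ℕ → ℕ → ℕ → ℤ
incWord p κ0 init kN =
  ultimately (replicate κ0 (ℤ.- + 1) ++ concatMap (segment p) init)
             (segHead kN) (segTail p kN)

-- Abstract setting: a field K containing ℚ, with a discrete valuation
-- ν : K → ℚ ∪ {+∞} extending ν_p (every finite extension K/ℚ_p with its
-- normalised ν_𝔭 is an instance).

record ValuedField (p : ℕ) (c ℓ : Level) : Set (lsuc (c ⊔ ℓ)) where
  field
    K : CommutativeRing c ℓ
  open CommutativeRing K public
  field
    0≉1     : ¬ (0# ≈ 1#)
    inverse : ∀ a → ¬ (a ≈ 0#) → ∃ λ b → a * b ≈ 1#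
    ι       : ℚ → Carrier
    ι-1     : ι 1ℚ ≈ 1#
    ι-+     : ∀ r s → ι (r ℚ.+ s) ≈ ι r + ι s
    ι-*     : ∀ r s → ι (r ℚ.* s) ≈ ι r * ι s
    ν       : Carrier → ℚ∞
    ν-cong  : ∀ {a b} → a ≈ b → ν a ≡ ν b
    ν-∞→0   : ∀ a → ν a ≡ ∞ → a ≈ 0#
    ν-0     : ν 0# ≡ ∞
    ν-*     : ∀ a b → ν (a * b) ≡ ν a +∞ ν b
    ν-+     : ∀ a b → min∞ (ν a) (ν b) ≤∞ ν (a + b)
    e       : ℕ                                  -- ramification index - 1
    ν-disc  : ∀ a q → ν a ≡ fin q → ∃ λ z → q ≡ z ℚ./ suc e
    ν-ι     : ∀ r → ν (ι r) ≡ toℚ∞ (νp p r)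

  pinv : ℚ
  pinv = inv p

  D : Carrier → Carrier
  D x with ν x
  ... | fin v = x * ι (v ℚ.* pinv)
  ... | ∞     = 0#

  Diter : ℕ → Carrier → Carrier
  Diter zero    x = x
  Diter (suc i) x = D (Diter i x)

  νseq : Carrier → ℕ → ℚ∞
  νseq x i = ν (Diter i x)

  _-∞_ : ℚ∞ → ℚ∞ → ℚ∞
  fin a -∞ fin b = fin (a ℚ.- b)
  _     -∞ _     = ∞

  incseq : Carrier → ℕ → ℚ∞
  incseq x i = νseq x (suc i) -∞ νseq x i

-- The valuations ν(Dⁱ x) form the orbit of v = ν(x) under w ↦ w + ν_p(w) − 1 on ℚ ∪ {∞},
-- so everything is a statement about this map; a step is −1 exactly when ν_p(w) = 0.
-- Since ν_p(v) = k ≥ 0, the points v, v − 1, …, v − (v mod p) + 1 are p-adic units and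
-- ⌊v⌋_p has valuation κ₁ ≥ 1 (were ⌊v⌋_p = 0, the orbit would die).  From a point W with
-- ν_p(W) = m ≥ 1 the orbit steps by m − 1 and then (m − 1) mod p times by −1, since the
-- points W + j with p ∤ j are units by the ultrametric inequality; so it follows S_{m,p} and
-- lands at W + ⌊m − 1⌋_p.  If m ≤ p this is W itself and S_{m,p} repeats forever.  Otherwise
-- ⌊m − 1⌋_p is a nonzero multiple of p whose valuation, the next κ, is smaller than m and is
-- also the valuation of the new point; so the κ's decrease until one lies in [1, p].

module Submission where

open import Data.Bool using (Bool; true; false; T)
open import Data.Empty using (⊥; ⊥-elim; ⊥-elim-irr)
open import Data.Integer as ℤ using (ℤ; +_; -[1+_]; 0ℤ)
import Data.Integer.DivMod as ℤD
import Data.Integer.Divisibility.Signed as S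
import Data.Integer.Properties as ℤP
open import Data.Integer.Tactic.RingSolver using (solve-∀)
open import Data.List using (List; []; _∷_; _++_; [_]; length; replicate; concatMap; applyUpTo)
import Data.List.Properties as List
open import Data.List.Relation.Unary.All as All using (All; []; _∷_)
open import Data.Nat
  using (ℕ; zero; suc; _+_; _*_; _∸_; _^_; _≤_; _<_; _<ᵇ_; z≤n; s≤s; _%_; _/_; NonZero; >-nonZero; NonTrivial)
open import Data.Nat using () renaming (_+_ to _+ℕ_)
open import Data.Nat.Coprimality using (Coprime; coprime-Bézout)
open import Data.Nat.DivMod
open import Data.Nat.Divisibility
open import Data.Nat.GCD using (module Bézout)
open import Data.Nat.Induction using (<-wellFounded)
open import Data.Nat.Primality using (Prime; euclidsLemma; prime⇒irreducible; prime⇒nonTrivial)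
open import Data.Nat.Properties
import Data.Nat.Solver
open import Data.Product using (Σ; ∃; _×_; _,_)
open import Data.Rational as ℚ using (ℚ; mkℚ; toℚᵘ; 0ℚ; 1ℚ)
open import Data.Rational using () renaming (_*_ to _*ℚ_)
import Data.Rational.Properties as ℚP
import Data.Rational.Solver
open import Data.Rational.Unnormalised as ℚᵘ using (mkℚᵘ; *≡*) renaming (_≃_ to _≃ᵘ_)
import Data.Rational.Unnormalised.Properties as ℚᵘP
open import Data.Sum using (_⊎_; inj₁; inj₂; [_,_]′)
open import Data.Unit using (tt)
open import Function using (_∘_)
open import Induction.WellFounded using (Acc; acc)
open import Level using (_⊔_)
open import Relation.Binary.Definitions using (Tri; tri<; tri≈; tri>)
open import Relation.Binary.PropositionalEquality hiding ([_])
open import Relation.Nullary using (¬_; yes; no; contradiction)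
open import Defs

module ℕ-Solver = Data.Nat.Solver.+-*-Solver
module ℚ-Solver = Data.Rational.Solver.+-*-Solver

-- Orbits of a self-map along a word

module Orbit {a ℓ} {A : Set a} (f : A → A) (_↦_ : A → ℤ → Set ℓ) where

  orbit : ℕ → A → A
  orbit zero    x = x
  orbit (suc n) x = orbit n (f x)

  orbit-suc : ∀ n x → orbit (suc n) x ≡ f (orbit n x)
  orbit-suc zero    x = refl
  orbit-suc (suc n) x = orbit-suc n (f x)

  data Run : A → List ℤ → A → Set (a ⊔ ℓ) where
    []  : ∀ {x} → Run x [] x
    _∷_ : ∀ {x h L y} → x ↦ h → Run (f x) L y → Run x (h ∷ L) y

  _++ᴿ_ : ∀ {x L y M z} → Run x L y → Run y M z → Run x (L ++ M) z
  []       ++ᴿ s = s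
  (st ∷ r) ++ᴿ s = st ∷ (r ++ᴿ s)

  run-orbit : ∀ {x L y} → Run x L y → ∀ n → orbit (length L + n) x ≡ orbit n y
  run-orbit []      n = refl
  run-orbit (_ ∷ r) n = run-orbit r n

  run-steps : ∀ {x L y} → Run x L y → ∀ i → i < length L → orbit i x ↦ nth L i
  run-steps (st ∷ r) zero    _         = st
  run-steps (st ∷ r) (suc i) (s≤s i<L) = run-steps r i i<L

  cycle-orbit : ∀ {y L} → Run y L y → ∀ k n → orbit (k * length L + n) y ≡ orbit n y
  cycle-orbit r zero    n = refl
  cycle-orbit {y} {L} r (suc k) n = begin
    orbit (length L + k * length L + n) y   ≡⟨ cong (λ m → orbit m y) (+-assoc (length L) _ n) ⟩
    orbit (length L + (k * length L + n)) y ≡⟨ run-orbit r _ ⟩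
    orbit (k * length L + n) y              ≡⟨ cycle-orbit r k n ⟩
    orbit n y                               ∎
    where open ≡-Reasoning

  cycle-steps : ∀ {y h t} → Run y (h ∷ t) y → ∀ i → orbit i y ↦ nth (h ∷ t) (i % suc (length t))
  cycle-steps {y} {h} {t} r i = subst (_↦ _) orbit≡ (run-steps r (i % n) (m%n<n i n))
    where
    n : ℕ
    n = suc (length t)
    orbit≡ : orbit (i % n) y ≡ orbit i y
    orbit≡ = begin
      orbit (i % n) y               ≡⟨ cycle-orbit r (i / n) (i % n) ⟨
      orbit (i / n * n + i % n) y   ≡⟨ cong (λ m → orbit m y) (+-comm (i / n * n) (i % n)) ⟩
      orbit (i % n + i / n * n) y   ≡⟨ cong (λ m → orbit m y) (m≡m%n+[m/n]*n i n) ⟨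
      orbit i y                     ∎
      where open ≡-Reasoning

  orbit-after : ∀ {x L y} → Run x L y → ∀ i → length L ≤ i → orbit i x ≡ orbit (i ∸ length L) y
  orbit-after {x} {L} r i L≤i =
    trans (cong (λ m → orbit m x) (sym (m+[n∸m]≡n L≤i))) (run-orbit r (i ∸ length L))

  orbit-absorbed : ∀ {x L y c} → Run x L y → f y ≡ c → f c ≡ c → ∀ i → length L < i → orbit i x ≡ c
  orbit-absorbed {L = L} {y} {c} r fy≡c fc≡c i L<i =
    trans (orbit-after r i (<⇒≤ L<i)) (after-y (i ∸ length L) (m<n⇒0<n∸m L<i))
    where
    stays : ∀ n → orbit n c ≡ c
    stays zero    = refl
    stays (suc n) = trans (cong (orbit n) fc≡c) (stays n)
    after-y : ∀ n → 0 < n → orbit n y ≡ c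
    after-y (suc n) _ = trans (cong (orbit n) fy≡c) (stays n)

  ultimately-steps : ∀ {x pre y h t} → Run x pre y → Run y (h ∷ t) y →
                     ∀ i → orbit i x ↦ ultimately pre h t i
  ultimately-steps {pre = pre} r c i with i <ᵇ length pre in i<ᵇpre
  ... | true  = run-steps r i (<ᵇ⇒< i (length pre) (subst T (sym i<ᵇpre) tt))
  ... | false = subst (_↦ _) (sym (orbit-after r i pre≤i)) (cycle-steps c (i ∸ length pre))
    where
    pre≤i : length pre ≤ i
    pre≤i = ≮⇒≥ (λ i<pre → subst T i<ᵇpre (<⇒<ᵇ i<pre))

  eventually-periodic : ∀ {x pre y per} → Run x pre y → Run y per y →
                        ∀ i → length pre ≤ i → orbit (i + length per) x ≡ orbit i x
  eventually-periodic {x} {pre} {y} {per} r c i pre≤i = begin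
    orbit (i + length per) x                  ≡⟨ orbit-after r _ (≤-trans pre≤i (m≤m+n i _)) ⟩
    orbit (i + length per ∸ length pre) y     ≡⟨ cong (λ m → orbit m y) (+-∸-comm (length per) pre≤i) ⟩
    orbit (i ∸ length pre + length per) y     ≡⟨ cong (λ m → orbit m y) (+-comm _ (length per)) ⟩
    orbit (length per + (i ∸ length pre)) y   ≡⟨ run-orbit c _ ⟩
    orbit (i ∸ length pre) y                  ≡⟨ orbit-after r i pre≤i ⟨
    orbit i x                                 ∎
    where open ≡-Reasoning

ℤ→ℚᵘ : ∀ i → toℚᵘ (ℤ→ℚ i) ≃ᵘ mkℚᵘ i 0
ℤ→ℚᵘ i = ℚP.toℚᵘ-fromℚᵘ (mkℚᵘ i 0)

ℤ→ℚ-+ : ∀ i j → ℤ→ℚ (i ℤ.+ j) ≡ ℤ→ℚ i ℚ.+ ℤ→ℚ j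
ℤ→ℚ-+ i j = ℚP.toℚᵘ-injective (begin
  toℚᵘ (ℤ→ℚ (i ℤ.+ j))                      ≈⟨ ℤ→ℚᵘ (i ℤ.+ j) ⟩
  mkℚᵘ (i ℤ.+ j) 0                           ≈⟨ *≡* (lemma i j) ⟩
  mkℚᵘ i 0 ℚᵘ.+ mkℚᵘ j 0                     ≈⟨ ℚᵘP.+-cong (ℤ→ℚᵘ i) (ℤ→ℚᵘ j) ⟨
  toℚᵘ (ℤ→ℚ i) ℚᵘ.+ toℚᵘ (ℤ→ℚ j)            ≈⟨ ℚP.toℚᵘ-homo-+ (ℤ→ℚ i) (ℤ→ℚ j) ⟨
  toℚᵘ (ℤ→ℚ i ℚ.+ ℤ→ℚ j)                    ∎)
  where
  open ℚᵘP.≃-Reasoning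
  lemma : ∀ i j → (i ℤ.+ j) ℤ.* + 1 ≡ (i ℤ.* + 1 ℤ.+ j ℤ.* + 1) ℤ.* + 1
  lemma = solve-∀

ℕ→ℚ-+ : ∀ m n → ℕ→ℚ (m + n) ≡ ℕ→ℚ m ℚ.+ ℕ→ℚ n
ℕ→ℚ-+ m n = trans (cong ℤ→ℚ (ℤP.pos-+ m n)) (ℤ→ℚ-+ (+ m) (+ n))

ℕ→ℚ-∸ : ∀ {m j} → j ≤ m → ℕ→ℚ m ℚ.- ℕ→ℚ j ≡ ℕ→ℚ (m ∸ j)
ℕ→ℚ-∸ {m} {j} j≤m = begin
  ℕ→ℚ m ℚ.- ℕ→ℚ j                       ≡⟨ cong (λ k → ℕ→ℚ k ℚ.- ℕ→ℚ j) (m∸n+n≡m j≤m) ⟨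
  ℕ→ℚ (m ∸ j + j) ℚ.- ℕ→ℚ j             ≡⟨ cong (ℚ._- ℕ→ℚ j) (ℕ→ℚ-+ (m ∸ j) j) ⟩
  ℕ→ℚ (m ∸ j) ℚ.+ ℕ→ℚ j ℚ.- ℕ→ℚ j      ≡⟨ solve 2 (λ a b → a :+ b :- b := a) refl (ℕ→ℚ (m ∸ j)) (ℕ→ℚ j) ⟩
  ℕ→ℚ (m ∸ j)                            ∎
  where
  open ≡-Reasoning
  open ℚ-Solver

[w+c]-w≡c : ∀ w c → w ℚ.+ c ℚ.- w ≡ c
[w+c]-w≡c = solve 2 (λ w c → w :+ c :- w := c) refl
  where open ℚ-Solver

+ℕ→ℚ-∸ : ∀ w {m j} → j ≤ m → w ℚ.+ ℕ→ℚ m ℚ.- ℕ→ℚ j ≡ w ℚ.+ ℕ→ℚ (m ∸ j)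
+ℕ→ℚ-∸ w {m} {j} j≤m = trans (ℚP.+-assoc w (ℕ→ℚ m) (ℚ.- ℕ→ℚ j)) (cong (w ℚ.+_) (ℕ→ℚ-∸ j≤m))

-ℕ→ℚ-suc : ∀ u j → u ℚ.- ℕ→ℚ j ℚ.+ ℤ→ℚ (ℤ.- + 1) ≡ u ℚ.- ℕ→ℚ (suc j)
-ℕ→ℚ-suc u j = begin
  u ℚ.- ℕ→ℚ j ℚ.+ ℚ.- 1ℚ        ≡⟨ solve 2 (λ u a → u :- a :- con 1ℚ := u :- (con 1ℚ :+ a)) refl u (ℕ→ℚ j) ⟩
  u ℚ.- (1ℚ ℚ.+ ℕ→ℚ j)          ≡⟨ cong (λ a → u ℚ.- a) (ℕ→ℚ-+ 1 j) ⟨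
  u ℚ.- ℕ→ℚ (suc j)             ∎
  where
  open ≡-Reasoning
  open ℚ-Solver

+[a+b]-+b : ∀ a b → + (a + b) ℤ.- + b ≡ + a
+[a+b]-+b a b = trans (ℤP.m-n≡m⊖n (a + b) b) (trans (ℤP.⊖-≥ (m≤n+m b a)) (cong +_ (m+n∸n≡m a b)))

+≡+⇒-≡- : ∀ {a b a′ b′} → a + b′ ≡ a′ + b → + a ℤ.- + b ≡ + a′ ℤ.- + b′
+≡+⇒-≡- {a} {b} {a′} {b′} eq = begin
  + a ℤ.- + b                         ≡⟨ shift (+ a) (+ b) (+ b′) ⟩
  (+ a ℤ.+ + b′) ℤ.- (+ b ℤ.+ + b′)   ≡⟨ cong (ℤ._- (+ b ℤ.+ + b′)) ℤ-eq ⟩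
  (+ a′ ℤ.+ + b) ℤ.- (+ b ℤ.+ + b′)   ≡⟨ unshift (+ a′) (+ b) (+ b′) ⟩
  + a′ ℤ.- + b′                       ∎
  where
  open ≡-Reasoning
  ℤ-eq : + a ℤ.+ + b′ ≡ + a′ ℤ.+ + b
  ℤ-eq = trans (sym (ℤP.pos-+ a b′)) (trans (cong +_ eq) (ℤP.pos-+ a′ b))
  shift : ∀ x y y′ → x ℤ.- y ≡ (x ℤ.+ y′) ℤ.- (y ℤ.+ y′)
  shift = solve-∀
  unshift : ∀ x′ y y′ → (x′ ℤ.+ y) ℤ.- (y ℤ.+ y′) ≡ x′ ℤ.- y′
  unshift = solve-∀

+≡-⇒ : ∀ {m a b} → + m ≡ + a ℤ.- + b → a ≡ m + b
+≡-⇒ {m} {a} {b} eq = ℤP.+-injective (begin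
  + a                    ≡⟨ cancel (+ a) (+ b) ⟩
  (+ a ℤ.- + b) ℤ.+ + b  ≡⟨ cong (ℤ._+ + b) eq ⟨
  + m ℤ.+ + b            ≡⟨ ℤP.pos-+ m b ⟨
  + (m + b)              ∎)
  where
  open ≡-Reasoning
  cancel : ∀ x y → x ≡ (x ℤ.- y) ℤ.+ y
  cancel = solve-∀

toℚᵘ-+ℕ : ∀ r {n d} m → toℚᵘ r ≃ᵘ mkℚᵘ n d → toℚᵘ (r ℚ.+ ℕ→ℚ m) ≃ᵘ mkℚᵘ (n ℤ.+ + m ℤ.* + suc d) d
toℚᵘ-+ℕ r {n} {d} m r≃ = begin
  toℚᵘ (r ℚ.+ ℕ→ℚ m)                 ≈⟨ ℚP.toℚᵘ-homo-+ r (ℕ→ℚ m) ⟩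
  toℚᵘ r ℚᵘ.+ toℚᵘ (ℕ→ℚ m)           ≈⟨ ℚᵘP.+-cong r≃ (ℤ→ℚᵘ (+ m)) ⟩
  mkℚᵘ n d ℚᵘ.+ mkℚᵘ (+ m) 0          ≈⟨ *≡* (lemma n (+ m) (+ suc d)) ⟩
  mkℚᵘ (n ℤ.+ + m ℤ.* + suc d) d      ∎
  where
  open ℚᵘP.≃-Reasoning
  lemma : ∀ n m D → (n ℤ.* + 1 ℤ.+ m ℤ.* D) ℤ.* D ≡ (n ℤ.+ m ℤ.* D) ℤ.* (D ℤ.* + 1)
  lemma = solve-∀

toℚᵘ-ℕ : ∀ r {n d} m → toℚᵘ r ≃ᵘ mkℚᵘ n d → toℚᵘ (r ℚ.- ℕ→ℚ m) ≃ᵘ mkℚᵘ (n ℤ.- + m ℤ.* + suc d) d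
toℚᵘ-ℕ r {n} {d} m r≃ = begin
  toℚᵘ (r ℚ.- ℕ→ℚ m)                     ≈⟨ ℚP.toℚᵘ-homo-+ r (ℚ.- ℕ→ℚ m) ⟩
  toℚᵘ r ℚᵘ.+ toℚᵘ (ℚ.- ℕ→ℚ m)           ≈⟨ ℚᵘP.+-cong r≃ -m≃ ⟩
  mkℚᵘ n d ℚᵘ.+ mkℚᵘ (ℤ.- + m) 0          ≈⟨ *≡* (lemma n (+ m) (+ suc d)) ⟩
  mkℚᵘ (n ℤ.- + m ℤ.* + suc d) d          ∎
  where
  open ℚᵘP.≃-Reasoning
  -m≃ : toℚᵘ (ℚ.- ℕ→ℚ m) ≃ᵘ mkℚᵘ (ℤ.- + m) 0
  -m≃ = ℚᵘP.≃-trans (ℚP.toℚᵘ-homo‿- (ℕ→ℚ m)) (ℚᵘP.-‿cong (ℤ→ℚᵘ (+ m)))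
  lemma : ∀ n m D → (n ℤ.* + 1 ℤ.+ ℤ.- m ℤ.* D) ℤ.* D ≡ (n ℤ.- m ℤ.* D) ℤ.* (D ℤ.* + 1)
  lemma = solve-∀

firstWith-applyUpTo : ∀ (P : ℕ → Bool) f {n s} → s < n → P (f s) ≡ true → (∀ t → t < s → P (f t) ≡ false) →
                      firstWith P (applyUpTo f n) ≡ f s
firstWith-applyUpTo P f {suc n} {zero} _ Pfs _ rewrite Pfs = refl
firstWith-applyUpTo P f {suc n} {suc s} (s≤s s<n) Pfs ¬Pft rewrite ¬Pft 0 (s≤s z≤n) =
  firstWith-applyUpTo P (f ∘ suc) s<n Pfs (λ t t<s → ¬Pft (suc t) (s≤s t<s))

m∸m%n≡m/n*n : ∀ m n .{{_ : NonZero n}} → m ∸ m % n ≡ m / n * n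
m∸m%n≡m/n*n m n = trans (cong (_∸ m % n) (m≡m%n+[m/n]*n m n)) (m+n∸m≡n (m % n) (m / n * n))

<%⇒∤∸ : ∀ {m n t} .{{_ : NonZero n}} → t < m % n → ¬ n ∣ m ∸ t
<%⇒∤∸ {m} {n} {t} t<m%n n∣m∸t =
  <⇒≱ (≤-<-trans (m∸n≤m (m % n) t) (m%n<n m n)) (∣⇒≤ {{>-nonZero (m<n⇒0<n∸m t<m%n)}} n∣m%n∸t)
  where
  m∸t≡ : m ∸ t ≡ m / n * n + (m % n ∸ t)
  m∸t≡ = trans (cong (_∸ t) (m≡m%n+[m/n]*n m n))
               (trans (+-∸-comm (m / n * n) (<⇒≤ t<m%n)) (+-comm (m % n ∸ t) (m / n * n)))
  n∣m%n∸t : n ∣ m % n ∸ t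
  n∣m%n∸t = ∣m+n∣m⇒∣n (subst (n ∣_) m∸t≡ n∣m∸t) (n∣m*n (m / n))

fin-injective : ∀ {a b} → _≡_ {A = ℤ∞} (fin a) (fin b) → a ≡ b
fin-injective refl = refl

geq1-cases : ∀ z → geq1 z ≡ true → z ≡ ∞ ⊎ ∃ λ m → z ≡ fin (+ suc m)
geq1-cases ∞                 _ = inj₁ refl
geq1-cases (fin (+ suc m))   _ = inj₂ (m , refl)
geq1-cases (fin (+ zero))    ()
geq1-cases (fin -[1+ n ])    ()

nthℕ-++ˡ : ∀ xs ys {i} → i < length xs → nthℕ (xs ++ ys) i ≡ nthℕ xs i
nthℕ-++ˡ (x ∷ xs) ys {zero}  _         = refl
nthℕ-++ˡ (x ∷ xs) ys {suc i} (s≤s i<) = nthℕ-++ˡ xs ys i<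

All-nthℕ : ∀ {P : ℕ → Set} {xs} → All P xs → ∀ {i} → i < length xs → P (nthℕ xs i)
All-nthℕ (px ∷ _)   {zero}  _         = px
All-nthℕ (_  ∷ pxs) {suc i} (s≤s i<) = All-nthℕ pxs i<

-- Valuations along the D-orbit

νD : ℕ → ℚ∞ → ℚ∞
νD p (fin w) = fin w +∞ toℚ∞ (νp p (w ℚ.* inv p))
νD p ∞       = ∞

module Dynamics (p : ℕ) where

  _↦_ : ℚ∞ → ℤ → Set
  fin w ↦ h = νD p (fin w) ≡ fin (w ℚ.+ ℤ→ℚ h)
  ∞     ↦ h = ⊥

  open Orbit (νD p) _↦_ public

  step-to : ∀ {w h w′ L y} → fin w ↦ h → w ℚ.+ ℤ→ℚ h ≡ w′ → Run (fin w′) L y → Run (fin w) (h ∷ L) y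
  step-to st w+h≡w′ r = st ∷ subst (λ a → Run a _ _) (sym (trans st (cong fin w+h≡w′))) r

  module _ {c ℓ} (F : ValuedField p c ℓ) where
    open ValuedField F using (ν; D; Diter; νseq; incseq; _-∞_; ν-*; ν-ι; ν-0; ι; pinv)

    ν-D : ∀ y → ν (D y) ≡ νD p (ν y)
    ν-D y with ν y in νy
    ... | fin w = trans (ν-* y (ι (w ℚ.* pinv))) (cong₂ _+∞_ νy (ν-ι (w ℚ.* pinv)))
    ... | ∞     = ν-0

    νseq≡orbit : ∀ x i → νseq x i ≡ orbit i (ν x)
    νseq≡orbit x zero    = refl
    νseq≡orbit x (suc i) =
      trans (ν-D (Diter i x)) (trans (cong (νD p) (νseq≡orbit x i)) (sym (orbit-suc i (ν x))))

    incseq-↦ : ∀ x i {h} → orbit i (ν x) ↦ h → incseq x i ≡ fin (ℤ→ℚ h)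
    incseq-↦ x i {h} st = begin
      incseq x i                            ≡⟨ cong₂ _-∞_ νseq-suc (νseq≡orbit x i) ⟩
      νD p (orbit i (ν x)) -∞ orbit i (ν x) ≡⟨ difference (orbit i (ν x)) st ⟩
      fin (ℤ→ℚ h)                           ∎
      where
      open ≡-Reasoning
      νseq-suc : νseq x (suc i) ≡ νD p (orbit i (ν x))
      νseq-suc = trans (νseq≡orbit x (suc i)) (orbit-suc i (ν x))
      difference : ∀ a → a ↦ h → νD p a -∞ a ≡ fin (ℤ→ℚ h)
      difference (fin w) st = trans (cong (_-∞ fin w) st) (cong fin ([w+c]-w≡c w (ℤ→ℚ h)))

    incseq-ultimately : ∀ x {pre y h t} → Run (ν x) pre y → Run y (h ∷ t) y →
                        ∀ i → incseq x i ≡ fin (ℤ→ℚ (ultimately pre h t i))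
    incseq-ultimately x r c i = incseq-↦ x i (ultimately-steps r c i)

    νseq-periodic : ∀ x {pre y per} → Run (ν x) pre y → Run y per y → ∀ i → length pre ≤ i →
                    νseq x (i + length per) ≡ νseq x i × incseq x (i + length per) ≡ incseq x i
    νseq-periodic x {pre} {per = per} r c i pre≤i =
      νseq-per i pre≤i , cong₂ _-∞_ (νseq-per (suc i) (≤-trans pre≤i (n≤1+n i))) (νseq-per i pre≤i)
      where
      νseq-per : ∀ i → length pre ≤ i → νseq x (i + length per) ≡ νseq x i
      νseq-per i pre≤i =
        trans (νseq≡orbit x (i + length per)) (trans (eventually-periodic r c i pre≤i) (sym (νseq≡orbit x i)))

-- p is written 2 + q so that multFuel and modℕ, which pattern-match on p, compute.
module PAdic (q : ℕ) (p-prime : Prime (suc (suc q))) where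

  p : ℕ
  p = suc (suc q)

  open Dynamics p public

  infix 4 p^_∥_
  record p^_∥_ (a n : ℕ) : Set where
    constructor exactly
    field
      p^a∣n   : p ^ a ∣ n
      p^1+a∤n : ¬ p ^ suc a ∣ n
  open p^_∥_

  ^-∣ : ∀ {a b} → a ≤ b → p ^ a ∣ p ^ b
  ^-∣ {a} {b} a≤b = divides (p ^ (b ∸ a))
    (trans (cong (p ^_) (sym (m∸n+n≡m a≤b))) (^-distribˡ-+-* p (b ∸ a) a))

  ∥-pos : ∀ {a n} → p^ a ∥ n → 0 < n
  ∥-pos {n = zero}  (exactly _ p^1+a∤0) = ⊥-elim (p^1+a∤0 (_ ∣0))
  ∥-pos {n = suc n} _                  = s≤s z≤n

  ∥-unique : ∀ {a b n} → p^ a ∥ n → p^ b ∥ n → a ≡ b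
  ∥-unique {a} {b} pa pb with <-cmp a b
  ... | tri< a<b _ _ = ⊥-elim (p^1+a∤n pa (∣-trans (^-∣ a<b) (p^a∣n pb)))
  ... | tri≈ _ a≡b _ = a≡b
  ... | tri> _ _ b<a = ⊥-elim (p^1+a∤n pb (∣-trans (^-∣ b<a) (p^a∣n pa)))

  p^0∥ : ∀ {n} → ¬ p ∣ n → p^ 0 ∥ n
  p^0∥ {n} p∤n = exactly (1∣ n) (λ p*1∣n → p∤n (subst (_∣ n) (*-identityʳ p) p*1∣n))

  p^k∥p^k : ∀ k → p^ k ∥ p ^ k
  p^k∥p^k k = exactly ∣-refl (>⇒∤ {{m^n≢0 p k}} p^k<p*p^k)
    where
    p^k<p*p^k : p ^ k < p * p ^ k
    p^k<p*p^k = subst (_< p * p ^ k) (*-identityˡ (p ^ k)) (*-monoˡ-< (p ^ k) {{m^n≢0 p k}} {1} {p} (s≤s (s≤s z≤n)))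

  multFuel-∥ : ∀ f n → 0 < n → n ≤ f → p^ multFuel p n f ∥ n
  multFuel-∥ zero    n 0<n n≤0 = ⊥-elim (<⇒≱ 0<n n≤0)
  multFuel-∥ (suc f) n 0<n n≤f with n % p ≟ 0
  ... | no  n%p≢0 = p^0∥ (λ p∣n → n%p≢0 (n∣m⇒m%n≡0 n p p∣n))
  ... | yes n%p≡0 = exactly (subst (p * p ^ a ∣_) (sym n≡p*n/p) (*-monoʳ-∣ p (p^a∣n ih)))
                            (λ p^2+a∣n → p^1+a∤n ih (*-cancelˡ-∣ p (subst (p ^ suc (suc a) ∣_) n≡p*n/p p^2+a∣n)))
    where
    p∣n : p ∣ n
    p∣n = m%n≡0⇒n∣m n p n%p≡0
    n≡p*n/p : n ≡ p * (n / p)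
    n≡p*n/p = trans (sym (m/n*n≡m p∣n)) (*-comm (n / p) p)
    ih : p^ multFuel p (n / p) f ∥ n / p
    ih = multFuel-∥ f (n / p) (m≥n⇒m/n>0 (∣⇒≤ {{>-nonZero 0<n}} p∣n))
                    (≤-pred (≤-trans (m/n<m n p {{>-nonZero 0<n}} (s≤s (s≤s z≤n))) n≤f))
    a : ℕ
    a = multFuel p (n / p) f

  multℕ-∥ : ∀ n → 0 < n → p^ multℕ p n ∥ n
  multℕ-∥ n 0<n = multFuel-∥ n n 0<n ≤-refl

  ∥-* : ∀ {a b m n} → p^ a ∥ m → p^ b ∥ n → p^ (a + b) ∥ m * n
  ∥-* {a} {b} {m} {n} (exactly (divides u m≡) p^1+a∤m) (exactly (divides w n≡) p^1+b∤n) =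
    exactly (subst (_∣ m * n) (sym (^-distribˡ-+-* p a b)) (*-pres-∣ (divides u m≡) (divides w n≡))) p^1+a+b∤mn
    where
    mn≡ : m * n ≡ (u * w) * p ^ (a + b)
    mn≡ = begin
      m * n                       ≡⟨ cong₂ _*_ m≡ n≡ ⟩
      (u * p ^ a) * (w * p ^ b)   ≡⟨ regroup u (p ^ a) w (p ^ b) ⟩
      (u * w) * (p ^ a * p ^ b)   ≡⟨ cong ((u * w) *_) (^-distribˡ-+-* p a b) ⟨
      (u * w) * p ^ (a + b)       ∎
      where
      open ≡-Reasoning
      regroup : ∀ u x w y → (u * x) * (w * y) ≡ (u * w) * (x * y)
      regroup = solve 4 (λ u x w y → (u :* x) :* (w :* y) := (u :* w) :* (x :* y)) refl
        where open ℕ-Solver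
    p^1+a+b∤mn : ¬ p ^ suc (a + b) ∣ m * n
    p^1+a+b∤mn d with euclidsLemma u w p-prime
                        (*-cancelʳ-∣ (p ^ (a + b)) {{m^n≢0 p (a + b)}} (subst (p ^ suc (a + b) ∣_) mn≡ d))
    ... | inj₁ p∣u = p^1+a∤m (subst (p ^ suc a ∣_) (sym m≡) (*-monoˡ-∣ (p ^ a) p∣u))
    ... | inj₂ p∣w = p^1+b∤n (subst (p ^ suc b ∣_) (sym n≡) (*-monoˡ-∣ (p ^ b) p∣w))

  ∥-+ : ∀ {a} x y → p^ a ∥ ℤ.∣ x ∣ → p ^ suc a ∣ ℤ.∣ y ∣ → p^ a ∥ ℤ.∣ x ℤ.+ y ∣
  ∥-+ {a} x y (exactly p^a∣x p^1+a∤x) p^1+a∣y = exactly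
    (S.∣⇒∣ᵤ (S.∣m∣n⇒∣m+n {+ (p ^ a)} {x} {y} (S.∣ᵤ⇒∣ p^a∣x) (S.∣ᵤ⇒∣ (∣-trans (^-∣ (n≤1+n a)) p^1+a∣y))))
    (λ p^1+a∣x+y → p^1+a∤x (S.∣⇒∣ᵤ (S.∣m+n∣n⇒∣m {+ (p ^ suc a)} {x} {y} (S.∣ᵤ⇒∣ p^1+a∣x+y) (S.∣ᵤ⇒∣ p^1+a∣y))))

  n<p^n : ∀ n → n < p ^ n
  n<p^n zero    = s≤s z≤n
  n<p^n (suc n) = begin-strict
    suc n             ≤⟨ n<p^n n ⟩
    p ^ n             <⟨ m<m+n (p ^ n) (m^n>0 p n) ⟩
    p ^ n + p ^ n     ≤⟨ +-monoʳ-≤ (p ^ n) (m≤m+n (p ^ n) (q * p ^ n)) ⟩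
    p * p ^ n         ∎
    where open ≤-Reasoning

  ∥⇒< : ∀ {a n} → p^ a ∥ n → a < n
  ∥⇒< {a} pa = <-≤-trans (n<p^n a) (∣⇒≤ {{>-nonZero (∥-pos pa)}} (p^a∣n pa))

  p∣⇒∥suc : ∀ {n} → 0 < n → p ∣ n → ∃ λ a → p^ suc a ∥ n
  p∣⇒∥suc {n} 0<n p∣n with multℕ p n | multℕ-∥ n 0<n
  ... | zero  | p^0∥n = ⊥-elim (p^1+a∤n p^0∥n (subst (_∣ n) (sym (*-identityʳ p)) p∣n))
  ... | suc a | p^1+a∥n = a , p^1+a∥n

  -- The p-adic valuation of rationals

  p∤1 : ¬ p ∣ 1
  p∤1 p∣1 with ∣1⇒≡1 p∣1
  ... | ()

  νp-nonzero : ∀ r → 0 < ℤ.∣ ℚ.↥ r ∣ → νp p r ≡ fin (+ multℕ p ℤ.∣ ℚ.↥ r ∣ ℤ.- + multℕ p (ℚ.↧ₙ r))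
  νp-nonzero (mkℚ (+ suc k) d c) _ = refl
  νp-nonzero (mkℚ -[1+ k ]  d c) _ = refl

  νp-≃ : ∀ r {i d a b} → toℚᵘ r ≃ᵘ mkℚᵘ i d → p^ a ∥ ℤ.∣ i ∣ → p^ b ∥ suc d → νp p r ≡ fin (+ a ℤ.- + b)
  νp-≃ (mkℚ n e c) {i} {d} {a} {b} (*≡* n*d≡i*e) pa pb =
    trans (νp-nonzero (mkℚ n e c) 0<∣n∣) (cong fin (+≡+⇒-≡- {multℕ p ℤ.∣ n ∣} {b′} {a} {b} exponents≡))
    where
    ∣n∣*d≡∣i∣*e : ℤ.∣ n ∣ * suc d ≡ ℤ.∣ i ∣ * suc e
    ∣n∣*d≡∣i∣*e = trans (sym (ℤP.abs-* n (+ suc d))) (trans (cong ℤ.∣_∣ n*d≡i*e) (ℤP.abs-* i (+ suc e)))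
    b′ : ℕ
    b′ = multℕ p (suc e)
    pe : p^ b′ ∥ suc e
    pe = multℕ-∥ (suc e) (s≤s z≤n)
    0<∣n∣ : 0 < ℤ.∣ n ∣
    0<∣n∣ with ℤ.∣ n ∣ | ∣n∣*d≡∣i∣*e
    ... | zero  | 0≡∣i∣*e = ⊥-elim (<⇒≢ (∥-pos (∥-* pa pe)) 0≡∣i∣*e)
    ... | suc _ | _       = s≤s z≤n
    exponents≡ : multℕ p ℤ.∣ n ∣ + b ≡ a + b′
    exponents≡ = ∥-unique (∥-* (multℕ-∥ ℤ.∣ n ∣ 0<∣n∣) pb) (subst (p^ a + b′ ∥_) (sym ∣n∣*d≡∣i∣*e) (∥-* pa pe))

  νp-≃-0 : ∀ r {d} → toℚᵘ r ≃ᵘ mkℚᵘ 0ℤ d → νp p r ≡ ∞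
  νp-≃-0 (mkℚ n e c) (*≡* n*d≡0) with ℤP.i*j≡0⇒i≡0∨j≡0 n n*d≡0
  ... | inj₁ refl = refl

  νp≡fin⇒ : ∀ r {z} → νp p r ≡ fin z →
            ∃ λ a → ∃ λ b → p^ a ∥ ℤ.∣ ℚ.↥ r ∣ × p^ b ∥ ℚ.↧ₙ r × z ≡ + a ℤ.- + b
  νp≡fin⇒ (mkℚ (+ suc k) d c) refl = _ , _ , multℕ-∥ (suc k) (s≤s z≤n) , multℕ-∥ (suc d) (s≤s z≤n) , refl
  νp≡fin⇒ (mkℚ -[1+ k ]  d c) refl = _ , _ , multℕ-∥ (suc k) (s≤s z≤n) , multℕ-∥ (suc d) (s≤s z≤n) , refl

  νp≡∞⇒≡0 : ∀ r → νp p r ≡ ∞ → r ≡ 0ℚ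
  νp≡∞⇒≡0 (mkℚ (+ zero) d c) _ = ℚP.↥p≡0⇒p≡0 (mkℚ (+ zero) d c) refl

  νp-≥1 : ∀ r {i d} → toℚᵘ r ≃ᵘ mkℚᵘ i d → ¬ p ∣ suc d → p ∣ ℤ.∣ i ∣ → geq1 (νp p r) ≡ true
  νp-≥1 r {i} r≃ p∤d p∣i with ℤ.∣ i ∣ in ∣i∣≡
  ... | zero  = cong geq1 (νp-≃-0 r (subst (λ j → toℚᵘ r ≃ᵘ mkℚᵘ j _) (ℤP.∣i∣≡0⇒i≡0 ∣i∣≡) r≃))
  ... | suc k with p∣⇒∥suc (s≤s z≤n) p∣i
  ...   | a , pa = cong geq1 (νp-≃ r r≃ (subst (p^ suc a ∥_) (sym ∣i∣≡) pa) (p^0∥ p∤d))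

  νp-ℕ : ∀ {a n} → p^ a ∥ n → νp p (ℕ→ℚ n) ≡ fin (+ a)
  νp-ℕ {a} {n} pa = trans (νp-≃ (ℕ→ℚ n) (ℤ→ℚᵘ (+ n)) pa (p^0∥ p∤1)) (cong fin (ℤP.+-identityʳ (+ a)))

  p∣⇒νp-ℕ-≥1 : ∀ {n} → p ∣ n → geq1 (νp p (ℕ→ℚ n)) ≡ true
  p∣⇒νp-ℕ-≥1 {n} = νp-≥1 (ℕ→ℚ n) (ℤ→ℚᵘ (+ n)) p∤1

  νp-* : ∀ r s {y z} → νp p r ≡ fin y → νp p s ≡ fin z → νp p (r ℚ.* s) ≡ fin (y ℤ.+ z)
  νp-* r@(mkℚ n d _) s@(mkℚ n′ d′ _) νr νs with νp≡fin⇒ r νr | νp≡fin⇒ s νs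
  ... | a , b , pa , pb , refl | a′ , b′ , pa′ , pb′ , refl =
    trans (νp-≃ (r ℚ.* s) (ℚP.toℚᵘ-homo-* r s)
                (subst (p^ a + a′ ∥_) (sym (ℤP.abs-* n n′)) (∥-* pa pa′)) (∥-* pb pb′))
          (cong fin (begin
            + (a + a′) ℤ.- + (b + b′)                ≡⟨ cong₂ ℤ._-_ (ℤP.pos-+ a a′) (ℤP.pos-+ b b′) ⟩
            (+ a ℤ.+ + a′) ℤ.- (+ b ℤ.+ + b′)        ≡⟨ interchange (+ a) (+ b) (+ a′) (+ b′) ⟩
            (+ a ℤ.- + b) ℤ.+ (+ a′ ℤ.- + b′)        ∎))
    where
    open ≡-Reasoning
    interchange : ∀ x y x′ y′ → (x ℤ.+ x′) ℤ.- (y ℤ.+ y′) ≡ (x ℤ.- y) ℤ.+ (x′ ℤ.- y′)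
    interchange = solve-∀

  νp-inv-p : νp p (inv p) ≡ fin (ℤ.- + 1)
  νp-inv-p = νp-≃ (inv p) (ℚP.toℚᵘ-fromℚᵘ (mkℚᵘ (+ 1) (suc q))) (p^0∥ p∤1)
                  (subst (p^ 1 ∥_) (*-identityʳ p) (p^k∥p^k 1))

  νp-+ℕ-< : ∀ W {m j c} → νp p W ≡ fin (+ m) → p^ j ∥ c → j < m → νp p (W ℚ.+ ℕ→ℚ c) ≡ fin (+ j)
  νp-+ℕ-< W@(mkℚ n d _) {m} {j} {c} νW pc j<m with νp≡fin⇒ W νW
  ... | a , b , pa , pb , m≡a-b =
    trans (νp-≃ (W ℚ.+ ℕ→ℚ c) (toℚᵘ-+ℕ W c ℚᵘP.≃-refl) p-sum pb) (cong fin (+[a+b]-+b j b))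
    where
    pcd : p^ j + b ∥ ℤ.∣ + c ℤ.* + suc d ∣
    pcd = subst (p^ j + b ∥_) (sym (ℤP.abs-* (+ c) (+ suc d))) (∥-* pc pb)
    1+j+b≤a : suc (j + b) ≤ a
    1+j+b≤a = subst (suc (j + b) ≤_) (sym (+≡-⇒ m≡a-b)) (+-monoˡ-≤ b j<m)
    p-sum : p^ j + b ∥ ℤ.∣ n ℤ.+ + c ℤ.* + suc d ∣
    p-sum = subst (λ x → p^ j + b ∥ ℤ.∣ x ∣) (ℤP.+-comm (+ c ℤ.* + suc d) n)
                  (∥-+ (+ c ℤ.* + suc d) n pcd (∣-trans (^-∣ 1+j+b≤a) (p^a∣n pa)))

  νp-nonneg⇒p∤↧ : ∀ r {k} → νp p r ≡ fin (+ k) → ¬ p ∣ ℚ.↧ₙ r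
  νp-nonneg⇒p∤↧ r@(mkℚ n d c) {k} νr p∣d with νp≡fin⇒ r νr
  ... | a , zero  , pa , pb , _   = p^1+a∤n pb (subst (_∣ suc d) (sym (*-identityʳ p)) p∣d)
  ... | a , suc b , pa , pb , k≡a-b = ⊥-elim-irr (p≢1 (c (p∣n , p∣d)))
    where
    p≢1 : p ≢ 1
    p≢1 ()
    1≤a : 1 ≤ a
    1≤a = subst (1 ≤_) (sym (+≡-⇒ k≡a-b)) (≤-trans (s≤s z≤n) (m≤n+m (suc b) k))
    p∣n : p ∣ ℤ.∣ n ∣
    p∣n = ∣-trans (subst (_∣ p ^ a) (*-identityʳ p) (^-∣ 1≤a)) (p^a∣n pa)

  -- Residues modulo p

  record IsResidue (r : ℚ) (s : ℕ) : Set where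
    field
      s<p   : s < p
      below : ∀ t → t < s → νp p (r ℚ.- ℕ→ℚ t) ≡ fin 0ℤ
      at    : geq1 (νp p (r ℚ.- ℕ→ℚ s)) ≡ true

  modp-residue : ∀ {r s} → IsResidue r s → modp p r ≡ s
  modp-residue {r} res = firstWith-applyUpTo (λ s → geq1 (νp p (r ℚ.- ℕ→ℚ s))) (λ s → s) s<p at
                                             (λ t t<s → cong geq1 (below t t<s))
    where open IsResidue res

  residue-ℕ : ∀ m → IsResidue (ℕ→ℚ m) (m % p)
  residue-ℕ m = record
    { s<p   = m%n<n m p
    ; below = λ t t<m%p → trans (cong (νp p) (ℕ→ℚ-∸ (≤-trans (<⇒≤ t<m%p) (m%n≤m m p))))
                                (νp-ℕ (p^0∥ (<%⇒∤∸ t<m%p)))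
    ; at    = trans (cong (λ x → geq1 (νp p x)) (trans (ℕ→ℚ-∸ (m%n≤m m p)) (cong ℕ→ℚ (m∸m%n≡m/n*n m p))))
                    (p∣⇒νp-ℕ-≥1 (n∣m*n (m / p)))
    }

  inverse-mod-p : ∀ {D} → ¬ p ∣ D → ∃ λ u → + p S.∣ u ℤ.* + D ℤ.- + 1
  inverse-mod-p {D} p∤D with coprime-Bézout D-coprime-p
    where
    D-coprime-p : Coprime D p
    D-coprime-p {i} (i∣D , i∣p) with prime⇒irreducible p-prime i∣p
    ... | inj₁ i≡1 = i≡1
    ... | inj₂ i≡p = ⊥-elim (p∤D (subst (_∣ D) i≡p i∣D))
  ... | Bézout.+- x y 1+y*p≡x*D = + x , S.divides (+ y) (begin
    + x ℤ.* + D ℤ.- + 1       ≡⟨ cong (ℤ._- + 1) (ℤP.pos-* x D) ⟨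
    + (x * D) ℤ.- + 1         ≡⟨ cong (λ k → + k ℤ.- + 1) 1+y*p≡x*D ⟨
    + (1 + y * p) ℤ.- + 1     ≡⟨ trans (cong (ℤ._- + 1) (ℤP.pos-+ 1 (y * p))) (cancel (+ 1) (+ (y * p))) ⟩
    + (y * p)                 ≡⟨ ℤP.pos-* y p ⟩
    + y ℤ.* + p               ∎)
    where
    open ≡-Reasoning
    cancel : ∀ a b → (a ℤ.+ b) ℤ.- a ≡ b
    cancel = solve-∀
  ... | Bézout.-+ x y 1+x*D≡y*p = ℤ.- + x , S.divides (ℤ.- + y) (begin
    ℤ.- + x ℤ.* + D ℤ.- + 1         ≡⟨ negate (+ x) (+ D) (+ 1) ⟩
    ℤ.- (+ 1 ℤ.+ + x ℤ.* + D)       ≡⟨ cong (λ k → ℤ.- (+ 1 ℤ.+ k)) (ℤP.pos-* x D) ⟨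
    ℤ.- (+ 1 ℤ.+ + (x * D))         ≡⟨ cong ℤ.-_ (trans (sym (ℤP.pos-+ 1 (x * D))) (cong +_ 1+x*D≡y*p)) ⟩
    ℤ.- + (y * p)                   ≡⟨ cong ℤ.-_ (ℤP.pos-* y p) ⟩
    ℤ.- (+ y ℤ.* + p)               ≡⟨ ℤP.neg-distribˡ-* (+ y) (+ p) ⟩
    ℤ.- + y ℤ.* + p                 ∎)
    where
    open ≡-Reasoning
    negate : ∀ a b c → ℤ.- a ℤ.* b ℤ.- c ≡ ℤ.- (c ℤ.+ a ℤ.* b)
    negate = solve-∀

  residue-minimal : ∀ n {D s t} → ¬ p ∣ D → s < p → + p S.∣ n ℤ.- + s ℤ.* + D → t < s →
                         ¬ p ∣ ℤ.∣ n ℤ.- + t ℤ.* + D ∣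
  residue-minimal n {D} {s} {t} p∤D s<p p∣n-sD t<s p∣n-tD =
    [ p∤s∸t , p∤D ]′ (euclidsLemma (s ∸ t) D p-prime p∣[s∸t]*D)
    where
    open ≡-Reasoning
    p∤s∸t : ¬ p ∣ s ∸ t
    p∤s∸t p∣s∸t = <⇒≱ (≤-<-trans (m∸n≤m s t) s<p) (∣⇒≤ {{>-nonZero (m<n⇒0<n∸m t<s)}} p∣s∸t)
    n-tD≡ : n ℤ.- + t ℤ.* + D ≡ (n ℤ.- + s ℤ.* + D) ℤ.+ + (s ∸ t) ℤ.* + D
    n-tD≡ = begin
      n ℤ.- + t ℤ.* + D                                         ≡⟨ split n (+ t) (+ (s ∸ t)) (+ D) ⟩
      (n ℤ.- (+ t ℤ.+ + (s ∸ t)) ℤ.* + D) ℤ.+ + (s ∸ t) ℤ.* + D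
        ≡⟨ cong (λ k → (n ℤ.- k ℤ.* + D) ℤ.+ + (s ∸ t) ℤ.* + D) t+[s∸t]≡s ⟩
      (n ℤ.- + s ℤ.* + D) ℤ.+ + (s ∸ t) ℤ.* + D                 ∎
      where
      t+[s∸t]≡s : + t ℤ.+ + (s ∸ t) ≡ + s
      t+[s∸t]≡s = trans (sym (ℤP.pos-+ t (s ∸ t))) (cong +_ (m+[n∸m]≡n (<⇒≤ t<s)))
      split : ∀ n t k D → n ℤ.- t ℤ.* D ≡ (n ℤ.- (t ℤ.+ k) ℤ.* D) ℤ.+ k ℤ.* D
      split = solve-∀
    p∣[s∸t]*D : p ∣ (s ∸ t) * D
    p∣[s∸t]*D = subst (p ∣_) (cong ℤ.∣_∣ (sym (ℤP.pos-* (s ∸ t) D)))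
                      (S.∣⇒∣ᵤ (S.∣m+n∣m⇒∣n (subst (+ p S.∣_) n-tD≡ (S.∣ᵤ⇒∣ p∣n-tD)) p∣n-sD))

  residue-by-inverse : ∀ n {D u s Q} → + p S.∣ u ℤ.* + D ℤ.- + 1 → n ℤ.* u ≡ + s ℤ.+ Q ℤ.* + p →
                       + p S.∣ n ℤ.- + s ℤ.* + D
  residue-by-inverse n {D} {u} {s} {Q} p∣uD-1 nu≡s+Qp =
    subst (+ p S.∣_) (sym n-sD≡) (S.∣m∣n⇒∣m+n (S.∣n⇒∣m*n (ℤ.- n) p∣uD-1) (S.∣n⇒∣m*n (Q ℤ.* + D) (S.∣-refl {+ p})))
    where
    open ≡-Reasoning
    n-sD≡ : n ℤ.- + s ℤ.* + D ≡ ℤ.- n ℤ.* (u ℤ.* + D ℤ.- + 1) ℤ.+ (Q ℤ.* + D) ℤ.* + p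
    n-sD≡ = begin
      n ℤ.- + s ℤ.* + D                                      ≡⟨ cong (λ k → n ℤ.- k ℤ.* + D) s≡nu-Qp ⟩
      n ℤ.- (n ℤ.* u ℤ.- Q ℤ.* + p) ℤ.* + D                  ≡⟨ expand n u Q (+ D) (+ p) ⟩
      ℤ.- n ℤ.* (u ℤ.* + D ℤ.- + 1) ℤ.+ (Q ℤ.* + D) ℤ.* + p ∎
      where
      cancel : ∀ r b → (r ℤ.+ b) ℤ.- b ≡ r
      cancel = solve-∀
      s≡nu-Qp : + s ≡ n ℤ.* u ℤ.- Q ℤ.* + p
      s≡nu-Qp = trans (sym (cancel (+ s) (Q ℤ.* + p))) (cong (ℤ._- Q ℤ.* + p) (sym nu≡s+Qp))
      expand : ∀ n u Q D P → n ℤ.- (n ℤ.* u ℤ.- Q ℤ.* P) ℤ.* D ≡ ℤ.- n ℤ.* (u ℤ.* D ℤ.- + 1) ℤ.+ (Q ℤ.* D) ℤ.* P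
      expand = solve-∀

  residue-ℤ : ∀ n {D} → ¬ p ∣ D →
              ∃ λ s → s < p × + p S.∣ n ℤ.- + s ℤ.* + D × (∀ t → t < s → ¬ p ∣ ℤ.∣ n ℤ.- + t ℤ.* + D ∣)
  residue-ℤ n {D} p∤D = residue (inverse-mod-p p∤D)
    where
    residue : (∃ λ u → + p S.∣ u ℤ.* + D ℤ.- + 1) →
              ∃ λ s → s < p × + p S.∣ n ℤ.- + s ℤ.* + D × (∀ t → t < s → ¬ p ∣ ℤ.∣ n ℤ.- + t ℤ.* + D ∣)
    residue (u , p∣uD-1) = s , s<p , p∣n-sD , λ t → residue-minimal n {D} {s} {t} p∤D s<p p∣n-sD
      where
      s : ℕ
      s = (n ℤ.* u) ℤD.%ℕ p
      s<p : s < p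
      s<p = ℤD.n%ℕd<d (n ℤ.* u) p
      p∣n-sD : + p S.∣ n ℤ.- + s ℤ.* + D
      p∣n-sD = residue-by-inverse n {D} {u} {s} {(n ℤ.* u) ℤD./ℕ p} p∣uD-1 (ℤD.a≡a%ℕn+[a/ℕn]*n (n ℤ.* u) p)

  residue-exists : ∀ r → ¬ p ∣ ℚ.↧ₙ r → ∃ (IsResidue r)
  residue-exists r@(mkℚ n d _) p∤d = residue (residue-ℤ n p∤d)
    where
    residue : (∃ λ s → s < p × + p S.∣ n ℤ.- + s ℤ.* + suc d × (∀ t → t < s → ¬ p ∣ ℤ.∣ n ℤ.- + t ℤ.* + suc d ∣)) →
              ∃ (IsResidue r)
    residue (s , s<p , p∣n-sd , p∤n-td) = s , record
      { s<p   = s<p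
      ; below = λ t t<s → νp-≃ (r ℚ.- ℕ→ℚ t) {n ℤ.- + t ℤ.* + suc d} {d} {0} {0}
                               (toℚᵘ-ℕ r t ℚᵘP.≃-refl) (p^0∥ (p∤n-td t t<s)) (p^0∥ p∤d)
      ; at    = νp-≥1 (r ℚ.- ℕ→ℚ s) {n ℤ.- + s ℤ.* + suc d} {d} (toℚᵘ-ℕ r s ℚᵘP.≃-refl) p∤d (S.∣⇒∣ᵤ p∣n-sd)
      }

  residue-modp : ∀ r {k} → νp p r ≡ fin (+ k) → IsResidue r (modp p r)
  residue-modp r νr = let s , res = residue-exists r (νp-nonneg⇒p∤↧ r νr) in
                      subst (IsResidue r) (sym (modp-residue res)) res

  -- Segments and the κ sequence

  ↦-νp : ∀ {w z} → νp p w ≡ fin z → fin w ↦ (z ℤ.- + 1)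
  ↦-νp {w} νw = cong (λ u → fin w +∞ toℚ∞ u) (νp-* w (inv p) νw νp-inv-p)

  νD-∞ : ∀ {w} → νp p w ≡ ∞ → νD p (fin w) ≡ ∞
  νD-∞ {w} νw = cong (λ u → fin w +∞ toℚ∞ (νp p u))
                     (trans (cong (ℚ._* inv p) (νp≡∞⇒≡0 w νw)) (ℚP.*-zeroˡ (inv p)))

  descent-from : ∀ u j s → (∀ t → j ≤ t → t < j + s → νp p (u ℚ.- ℕ→ℚ t) ≡ fin 0ℤ) →
                 Run (fin (u ℚ.- ℕ→ℚ j)) (replicate s (ℤ.- + 1)) (fin (u ℚ.- ℕ→ℚ (j + s)))
  descent-from u j zero    _    =
    subst (λ k → Run (fin (u ℚ.- ℕ→ℚ j)) [] (fin (u ℚ.- ℕ→ℚ k))) (sym (+-identityʳ j)) []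
  descent-from u j (suc s) unit =
    step-to (↦-νp (unit j ≤-refl (m<m+n j (s≤s z≤n)))) (-ℕ→ℚ-suc u j)
      (subst (λ k → Run (fin (u ℚ.- ℕ→ℚ (suc j))) (replicate s (ℤ.- + 1)) (fin (u ℚ.- ℕ→ℚ k))) (sym (+-suc j s))
        (descent-from u (suc j) s (λ t j<t t<j+s → unit t (<⇒≤ j<t) (subst (t <_) (sym (+-suc j s)) t<j+s))))

  descent : ∀ u s → (∀ t → t < s → νp p (u ℚ.- ℕ→ℚ t) ≡ fin 0ℤ) →
            Run (fin u) (replicate s (ℤ.- + 1)) (fin (u ℚ.- ℕ→ℚ s))
  descent u s unit = subst (λ a → Run (fin a) (replicate s (ℤ.- + 1)) (fin (u ℚ.- ℕ→ℚ s))) (ℚP.+-identityʳ u)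
                           (descent-from u 0 s (λ t _ → unit t))

  segment-run : ∀ W {m} → νp p W ≡ fin (+ suc m) →
                Run (fin W) (segment p (suc m)) (fin (W ℚ.+ ℕ→ℚ (m / p * p)))
  segment-run W {m} νW =
    step-to (↦-νp νW) refl
      (subst (λ a → Run (fin (W ℚ.+ ℕ→ℚ m)) (replicate (m % p) (ℤ.- + 1)) (fin a)) end≡
             (descent (W ℚ.+ ℕ→ℚ m) (m % p) unit))
    where
    unit : ∀ t → t < m % p → νp p (W ℚ.+ ℕ→ℚ m ℚ.- ℕ→ℚ t) ≡ fin 0ℤ
    unit t t<m%p = trans (cong (νp p) (+ℕ→ℚ-∸ W (≤-trans (<⇒≤ t<m%p) (m%n≤m m p))))
                         (νp-+ℕ-< W νW (p^0∥ (<%⇒∤∸ t<m%p)) (s≤s z≤n))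
    end≡ : W ℚ.+ ℕ→ℚ m ℚ.- ℕ→ℚ (m % p) ≡ W ℚ.+ ℕ→ℚ (m / p * p)
    end≡ = trans (+ℕ→ℚ-∸ W (m%n≤m m p)) (cong (λ k → W ℚ.+ ℕ→ℚ k) (m∸m%n≡m/n*n m p))

  ⌊⌋-∥ : ∀ {m} → p ≤ m → ∃ λ a → suc a < m × p^ suc a ∥ m / p * p
  ⌊⌋-∥ {m} p≤m = bound (p∣⇒∥suc (*-mono-≤ (m≥n⇒m/n>0 p≤m) (s≤s z≤n)) (n∣m*n (m / p)))
    where
    bound : (∃ λ a → p^ suc a ∥ m / p * p) → ∃ λ a → suc a < m × p^ suc a ∥ m / p * p
    bound (a , pa) = a , <-≤-trans (∥⇒< pa) (m/n*n≤m m p) , pa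

  floorp-ℕ : ∀ m → floorp p (ℕ→ℚ m) ≡ ℕ→ℚ (m / p * p)
  floorp-ℕ m = begin
    ℕ→ℚ m ℚ.- ℕ→ℚ (modp p (ℕ→ℚ m))   ≡⟨ cong (λ s → ℕ→ℚ m ℚ.- ℕ→ℚ s) (modp-residue (residue-ℕ m)) ⟩
    ℕ→ℚ m ℚ.- ℕ→ℚ (m % p)            ≡⟨ ℕ→ℚ-∸ (m%n≤m m p) ⟩
    ℕ→ℚ (m ∸ m % p)                   ≡⟨ cong ℕ→ℚ (m∸m%n≡m/n*n m p) ⟩
    ℕ→ℚ (m / p * p)                   ∎
    where open ≡-Reasoning

  module _ (v : ℚ) where

    κtail-next : ∀ i {m} → κtail p v i ≡ fin (+ suc m) → κtail p v (suc i) ≡ νp p (ℕ→ℚ (m / p * p))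
    κtail-next i {m} κi with κtail p v i | κi
    ... | fin _ | refl = cong (νp p) (trans (cong (floorp p) (ℕ→ℚ-∸ {suc m} {1} (s≤s z≤n))) (floorp-ℕ m))

    κtail-∞ : ∀ i → κtail p v i ≡ ∞ → κtail p v (suc i) ≡ ∞
    κtail-∞ i κi with κtail p v i | κi
    ... | ∞ | refl = refl

    κtail-∞-stays : ∀ {i} → κtail p v i ≡ ∞ → ∀ j → κtail p v (i + j) ≡ ∞
    κtail-∞-stays {i} κi zero    = trans (cong (κtail p v) (+-identityʳ i)) κi
    κtail-∞-stays {i} κi (suc j) = trans (cong (κtail p v) (+-suc i j)) (κtail-∞ (i + j) (κtail-∞-stays {i} κi j))

    -- κ_{i+1}, κ_{i+2}, … reads init, kN, ∞, ∞, …, and the valuation orbit from W runs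
    -- through the segments of init and then cycles through S_{kN,p}.
    record Tail (i : ℕ) (W : ℚ) : Set where
      field
        init       : List ℕ
        kN         : ℕ
        κ-word     : ∀ j → j ≤ length init → κtail p v (i + j) ≡ fin (+ nthℕ (init ++ [ kN ]) j)
        κ-∞        : ∀ j → length init < j → κtail p v (i + j) ≡ ∞
        init>p     : All (p <_) init
        1≤kN       : 1 ≤ kN
        kN≤p       : kN ≤ p
        loop-point : ℚ
        run-init   : Run (fin W) (concatMap (segment p) init) (fin loop-point)
        run-loop   : Run (fin loop-point) (segment p kN) (fin loop-point)

    tail-last : ∀ {m} i W → κtail p v i ≡ fin (+ suc m) → νp p W ≡ fin (+ suc m) → m < p → Tail i W
    tail-last {m} i W κi νW m<p = record
      { init = [] ; kN = suc m
      ; κ-word = λ { zero _ → trans (cong (κtail p v) (+-identityʳ i)) κi }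
      ; κ-∞ = λ { (suc j) _ → trans (cong (κtail p v) (+-suc i j)) (κtail-∞-stays {suc i} κ1+i j) }
      ; init>p = [] ; 1≤kN = s≤s z≤n ; kN≤p = m<p
      ; loop-point = W ; run-init = []
      ; run-loop = subst (λ a → Run (fin W) (segment p (suc m)) (fin a)) W+0≡W (segment-run W νW)
      }
      where
      m/p≡0 : m / p ≡ 0
      m/p≡0 = m<n⇒m/n≡0 m<p
      κ1+i : κtail p v (suc i) ≡ ∞
      κ1+i = trans (κtail-next i κi) (cong (λ k → νp p (ℕ→ℚ (k * p))) m/p≡0)
      W+0≡W : W ℚ.+ ℕ→ℚ (m / p * p) ≡ W
      W+0≡W = trans (cong (λ k → W ℚ.+ ℕ→ℚ (k * p)) m/p≡0) (ℚP.+-identityʳ W)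

    tail : ∀ {m} → Acc _<_ m → ∀ i W → κtail p v i ≡ fin (+ suc m) → νp p W ≡ fin (+ suc m) → Tail i W
    tail {m} (acc smaller) i W κi νW with m <? p
    ... | yes m<p = tail-last i W κi νW m<p
    ... | no  m≮p = extend (⌊⌋-∥ (≮⇒≥ m≮p))
      where
      extend : (∃ λ a → suc a < m × p^ suc a ∥ m / p * p) → Tail i W
      extend (a , 1+a<m , pa) = record
        { init = suc m ∷ R.init ; kN = R.kN
        ; κ-word = λ { zero _ → trans (cong (κtail p v) (+-identityʳ i)) κi
                     ; (suc j) (s≤s j≤) → trans (cong (κtail p v) (+-suc i j)) (R.κ-word j j≤) }
        ; κ-∞ = λ { (suc j) (s≤s j>) → trans (cong (κtail p v) (+-suc i j)) (R.κ-∞ j j>) }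
        ; init>p = s≤s (≮⇒≥ m≮p) ∷ R.init>p ; 1≤kN = R.1≤kN ; kN≤p = R.kN≤p
        ; loop-point = R.loop-point ; run-init = segment-run W νW ++ᴿ R.run-init
        ; run-loop = R.run-loop
        }
        where
        module R = Tail (tail (smaller (<-trans (n<1+n a) 1+a<m)) (suc i) (W ℚ.+ ℕ→ℚ (m / p * p))
                              (trans (κtail-next i κi) (νp-ℕ pa)) (νp-+ℕ-< W νW pa (<-trans 1+a<m (n<1+n m))))

    Tail-unique : ∀ {W} (T : Tail 0 W) → ∀ M {m} → 1 ≤ M → κ p v M ≡ fin (+ m) → m ≤ p →
                  M ≡ suc (length (Tail.init T))
    Tail-unique T (suc j) {m} _ κj m≤p = cong suc (by-cases (<-cmp j (length init)))
      where
      open Tail T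
      by-cases : Tri (j < length init) (j ≡ length init) (length init < j) → j ≡ length init
      by-cases (tri< j<N _ _) = ⊥-elim (<⇒≱ (All-nthℕ init>p j<N) (subst (_≤ p) m≡nth m≤p))
        where
        m≡nth : m ≡ nthℕ init j
        m≡nth = trans (ℤP.+-injective (fin-injective (trans (sym κj) (κ-word j (<⇒≤ j<N)))))
                      (nthℕ-++ˡ init [ kN ] j<N)
      by-cases (tri≈ _ j≡N _) = j≡N
      by-cases (tri> _ _ j>N) = contradiction (trans (sym κj) (κ-∞ j j>N)) λ ()

    initial-run : ∀ {k} → νp p v ≡ fin (+ k) → Run (fin v) (replicate (modp p v) (ℤ.- + 1)) (fin (floorp p v))
    initial-run νv = descent v (modp p v) (IsResidue.below (residue-modp v νv))

    alive⇒tail : ∀ {k} → νp p v ≡ fin (+ k) → ¬ (∃ λ n → ∀ i → n ≤ i → orbit i (fin v) ≡ ∞) → Tail 0 (floorp p v)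
    alive⇒tail νv alive = by-cases (geq1-cases (νp p (floorp p v)) (IsResidue.at (residue-modp v νv)))
      where
      by-cases : νp p (floorp p v) ≡ ∞ ⊎ ∃ (λ m → νp p (floorp p v) ≡ fin (+ suc m)) → Tail 0 (floorp p v)
      by-cases (inj₁ ν∞)       = ⊥-elim (alive (_ , orbit-absorbed (initial-run νv) (νD-∞ ν∞) refl))
      by-cases (inj₂ (m , νm)) = tail (<-wellFounded m) 0 (floorp p v) νm νm

  length-segment : ∀ {k} → 1 ≤ k → k ≤ p → length (segment p k) ≡ k
  length-segment {suc k} _ k<p = cong suc (trans (List.length-replicate (k % p)) (m<n⇒m%n≡m k<p))

theorem2p8 : ∀ {c ℓ} (p : ℕ) → Prime p → (F : ValuedField p c ℓ) →
    let open ValuedField F in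
    (x : Carrier) → ¬ (x ≈ 0#) →
    (b : ℚ) (k : ℕ) → νp p b ≡ fin (+ 0) → ν x ≡ fin (b *ℚ ℕ→ℚ (p ^ k)) →
    ¬ (∃ λ n → ∀ i → n ≤ i → νseq x i ≡ ∞) →
    let v = b *ℚ ℕ→ℚ (p ^ k) in
    Σ (List ℕ) λ init → Σ ℕ λ kN →
      let N = suc (length init) in
      (∀ i → 1 ≤ i → i ≤ N → κ p v i ≡ fin (+ nthℕ (init ++ [ kN ]) (i ∸ 1)))
      × All (1 ≤_) init × 1 ≤ kN × kN ≤ p
      × (∀ i → N < i → κ p v i ≡ ∞)
      × (∀ M m → 1 ≤ M → κ p v M ≡ fin (+ m) → 1 ≤ m → m ≤ p → M ≡ N)
      × (∀ i → incseq x i ≡ fin (ℤ→ℚ (incWord p (modp p v) init kN i)))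
      × (∃ λ n₀ → ∀ i → n₀ ≤ i →
           (νseq x (i +ℕ kN) ≡ νseq x i) × (incseq x (i +ℕ kN) ≡ incseq x i))
theorem2p8 zero          p-prime = ⊥-elim (NonTrivial.nonTrivial (prime⇒nonTrivial p-prime))
theorem2p8 (suc zero)    p-prime = ⊥-elim (NonTrivial.nonTrivial (prime⇒nonTrivial p-prime))
theorem2p8 (suc (suc q)) p-prime F x _ b k νb νx alive =
  init , kN , κ-word′ , All.map (≤-trans (s≤s z≤n)) init>p , 1≤kN , kN≤p , κ-∞′ ,
  (λ M m 1≤M κM _ → Tail-unique v tail₀ M 1≤M κM) ,
  incseq-ultimately F x run-pre run-loop ,
  (length pre , λ i pre≤i → subst (λ n → νseq x (i + n) ≡ νseq x i × incseq x (i + n) ≡ incseq x i)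
                                   (length-segment 1≤kN kN≤p) (νseq-periodic F x run-pre run-loop i pre≤i))
  where
  open ValuedField F using (ν; νseq; incseq)
  open PAdic q p-prime
  v : ℚ
  v = b ℚ.* ℕ→ℚ (p ^ k)
  νv : νp p v ≡ fin (+ k)
  νv = νp-* b (ℕ→ℚ (p ^ k)) νb (νp-ℕ (p^k∥p^k k))
  orbit-alive : ¬ (∃ λ n → ∀ i → n ≤ i → orbit i (fin v) ≡ ∞)
  orbit-alive (n , dead) = alive (n , λ i n≤i → trans (νseq≡orbit F x i) (trans (cong (orbit i) νx) (dead i n≤i)))
  tail₀ : Tail v 0 (floorp p v)
  tail₀ = alive⇒tail v νv orbit-alive
  open Tail tail₀
  pre : List ℤ
  pre = replicate (modp p v) (ℤ.- + 1) ++ concatMap (segment p) init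
  run-pre : Run (ν x) pre (fin loop-point)
  run-pre = subst (λ a → Run a pre (fin loop-point)) (sym νx) (initial-run v νv ++ᴿ run-init)
  κ-word′ : ∀ i → 1 ≤ i → i ≤ suc (length init) → κ p v i ≡ fin (+ nthℕ (init ++ [ kN ]) (i ∸ 1))
  κ-word′ (suc j) _ (s≤s j≤N) = κ-word j j≤N
  κ-∞′ : ∀ i → suc (length init) < i → κ p v i ≡ ∞
  κ-∞′ (suc j) (s≤s N<j) = κ-∞ j N<j
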